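{- For every integer $n>2$, Player 2 (the player who does not make the first move) has a winning strategy in the Zeckendorf Game on $n$.
   Context: Fibonacci numbers are indexed as $F_1=1$, $F_2=2$, $F_{i+1}=F_i+F_{i-1}$. The Zeckendorf Game on $n$: the state is an unordered multiset of Fibonacci numbers summing to $n$, initially $n$ copies of $F_1$. Two players alternate turns, Player 1 moving first; a move is one of: (1) replace $F_{i-1},F_i$ by $F_{i+1}$; (2a) replace $F_1,F_1$ by $F_2$; (2b) replace $F_2,F_2$ by $F_1,F_3$; (2c) for $i\ge3$, replace $F_i,F_i$ by $F_{i-2},F_{i+1}$. The game ends when no legal move remains (this is exactly when the state is the Zeckendorf decomposition of $n$, the unique representation of $n$ as a sum of distinct non-adjacent Fibonacci numbers), and the player who made the last move wins. -}

module Defs where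

open import Data.Nat using (ℕ; zero; suc; _+_)
open import Data.List using (List; []; _∷_; _++_; replicate)
open import Data.Product using (Σ; _×_; ∃-syntax)
open import Data.List.Relation.Binary.Permutation.Propositional using (_↭_)

-- Fibonacci numbers with the paper's indexing F₁ = 1, F₂ = 2, F_{i+1} = F_i + F_{i-1}.
-- (fib 0 is a dummy value; only indices ≥ 1 occur.)  Used for documentation /
-- to make the meaning of the index representation explicit.
fib : ℕ → ℕ
fib 0 = 1
fib 1 = 1
fib 2 = 2
fib (suc (suc (suc i))) = fib (suc (suc i)) + fib (suc i)

-- A game state is an unordered multiset of Fibonacci numbers, represented by a
-- list of their indices (F_i is stored as i ≥ 1), considered up to permutation.

data Rule : List ℕ → List ℕ → Set where
  -- (1)  F_{i-1}, F_i  ↦  F_{i+1}   (i-1 = suc k ≥ 1)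
  merge   : ∀ k → Rule (suc k ∷ suc (suc k) ∷ []) (suc (suc (suc k)) ∷ [])
  split1  : Rule (1 ∷ 1 ∷ []) (2 ∷ [])
  split2  : Rule (2 ∷ 2 ∷ []) (1 ∷ 3 ∷ [])
  -- (2c) F_i, F_i ↦ F_{i-2}, F_{i+1} for i = k + 3 ≥ 3
  splitGe : ∀ k → Rule (3 + k ∷ 3 + k ∷ []) (suc k ∷ 4 + k ∷ [])

Move : List ℕ → List ℕ → Set
Move s t = ∃[ lhs ] ∃[ rhs ] ∃[ rest ]
  (Rule lhs rhs × (s ↭ lhs ++ rest) × (t ↭ rhs ++ rest))

-- Normal-play game values (last player to move wins).
-- Win s  : the player about to move from s has a winning strategy.
-- Lose s : the player about to move from s loses, i.e. the player who just moved
--          (the opponent) has a winning strategy.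
-- Inductive, so strategies are well-founded (plays are finite, as in the game).
data Win  : List ℕ → Set
data Lose : List ℕ → Set

data Win where
  win : ∀ {s} t → Move s t → Lose t → Win s

data Lose where
  lose : ∀ {s} → (∀ t → Move s t → Win t) → Lose s

initial : ℕ → List ℕ
initial n = replicate n 1

module Submission where

-- The proof is a strategy-stealing argument and therefore needs determinacy:
-- every state is a win or a loss for the player to move.  Determinacy follows
-- because (i) the moves of a state can be listed (`successors`), complete up to
-- permutation, and (ii) the game terminates: every rule preserves the value
-- Σ F_i and strictly increases the potential Σ 3^i, which is bounded by
-- (Σ F_i) · 3^(Σ F_i), so their gap is a well-founded measure.
--
-- The moves of a state 1^m ++ T, where T only has entries F_i with i ≥ 3, are
-- either a merge of two 1s or a move inside T.  With this we play the game out
-- for 3 ≤ n ≤ 7, and for n ≥ 8 we show that a first-player win would force the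
-- play 1^n → 1^(n-2) 2 → 1^(n-3) 3 → 1^(n-5) 2 3 → … making the state
-- 1^(n-7) 2 4 both won and lost.  Determinacy then yields the theorem.

open import Defs
open import Data.Nat using (ℕ; zero; suc; _+_; _*_; _^_; _∸_; _≤_; _<_; z≤n; s≤s; z<s; _≟_; _≤?_; >-nonZero)
open import Data.Nat.Properties
  using (+-comm; +-mono-≤; +-monoˡ-<; *-monoˡ-<; *-distribʳ-+; ^-monoʳ-≤; m^n≢0; ∸-monoʳ-<;
         ≤-refl; ≤-trans; ≤-<-trans; <-irrefl; m≤m+n; m≤n+m; m<m+n; m≤n*m; ≰⇒>; m≤n⇒∃[o]m+o≡n;
         module ≤-Reasoning)
open import Data.Nat.ListAction using (sum)
open import Data.Nat.ListAction.Properties using (sum-++; sum-↭)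
open import Data.Nat.Tactic.RingSolver using (solve-∀)
open import Data.Nat.Induction using (<-wellFounded)
open import Induction.WellFounded using (Acc; acc)
open import Data.List using (List; []; _∷_; _++_; map; concatMap; length; replicate)
open import Data.List.Properties using (map-++; ++-identityʳ)
open import Data.List.Relation.Unary.Any using (Any; here; there; any?; satisfied)
import Data.List.Relation.Unary.Any as Any
import Data.List.Relation.Unary.Any.Properties as Any
open import Data.List.Relation.Unary.All using (All; []; _∷_; lookupWith) renaming (head to All-head)
open import Data.List.Relation.Unary.All.Properties using (¬Any⇒All¬)
open import Data.List.Membership.Propositional using (_∈_)
open import Data.List.Membership.Propositional.Properties using (∈-++⁻)
open import Data.List.Relation.Binary.Permutation.Propositional
  using (_↭_; prep; swap; ↭-refl; ↭-sym; ↭-trans; ↭-reflexive)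
open import Data.List.Relation.Binary.Permutation.Propositional.Properties
  using (∈-resp-↭; drop-∷; map⁺; ++⁺ˡ; shift; shifts; ↭-length; ↭-singleton-inv; All-resp-↭)
open import Data.Product using (Σ; _×_; _,_; proj₁; ∃-syntax)
open import Data.Sum using (_⊎_; inj₁; inj₂)
open import Data.Empty using (⊥-elim)
open import Relation.Nullary using (¬_; Dec; yes; no)
open import Relation.Binary.PropositionalEquality
  using (_≡_; refl; sym; cong; subst; subst₂; module ≡-Reasoning) renaming (trans to ≡-trans)

rule-lhs : ∀ {l r} → Rule l r → ∃[ a ] ∃[ b ] l ≡ a ∷ b ∷ []
rule-lhs (merge k)   = _ , _ , refl
rule-lhs split1      = _ , _ , refl
rule-lhs split2      = _ , _ , refl
rule-lhs (splitGe k) = _ , _ , refl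

move-↭ : ∀ {s s' t t'} → s ↭ s' → t ↭ t' → Move s t → Move s' t'
move-↭ p q (l , r , rest , ru , ps , qt) =
  l , r , rest , ru , ↭-trans (↭-sym p) ps , ↭-trans (↭-sym q) qt

win-↭ : ∀ {s s'} → s ↭ s' → Win s → Win s'
win-↭ p (win t m l) = win t (move-↭ p ↭-refl m) l

lose-↭ : ∀ {s s'} → s ↭ s' → Lose s → Lose s'
lose-↭ p (lose f) = lose λ t m → f t (move-↭ (↭-sym p) ↭-refl m)

win-lose-exclusive : ∀ {s} → Win s → ¬ Lose s
win-lose-exclusive (win t m l) (lose f) = win-lose-exclusive (f t m) l

won-after : ∀ {s t} → Lose s → Move s t → Win t
won-after (lose f) m = f _ m

only-move-lost : ∀ {s u} → (∀ {t} → Move s t → t ↭ u) → Win u → Lose s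
only-move-lost only w = lose λ _ m → win-↭ (↭-sym (only m)) w

reply-lost : ∀ {s u} → (∀ {t} → Move s t → t ↭ u ⊎ Win t) → Win s → Lose u
reply-lost options (win t m l) with options m
... | inj₁ p = lose-↭ p l
... | inj₂ w = ⊥-elim (win-lose-exclusive w l)

record Removal (xs : List ℕ) : Set where
  constructor removal
  field
    elem  : ℕ
    rest  : List ℕ
    perm  : xs ↭ elem ∷ rest
open Removal

removals : (xs : List ℕ) → List (Removal xs)
removals []       = []
removals (x ∷ xs) = removal x xs ↭-refl ∷ map keep (removals xs)
  where
  keep : Removal xs → Removal (x ∷ xs)
  keep (removal a r p) = removal a (x ∷ r) (↭-trans (prep x p) (swap x a ↭-refl))

removals-complete : ∀ {a xs} → a ∈ xs → Any (λ ρ → elem ρ ≡ a) (removals xs)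
removals-complete (here refl) = here refl
removals-complete (there a∈xs) = there (Any.map⁺ (removals-complete a∈xs))

removal-of : ∀ {a xs u} → xs ↭ a ∷ u → Any (λ ρ → elem ρ ≡ a × rest ρ ↭ u) (removals xs)
removal-of {a} {xs} {u} p = Any.map (λ {ρ} → rest-↭ {ρ}) (removals-complete (∈-resp-↭ (↭-sym p) (here refl)))
  where
  rest-↭ : ∀ {ρ} → elem ρ ≡ a → elem ρ ≡ a × rest ρ ↭ u
  rest-↭ {removal a r q} refl = refl , drop-∷ (↭-trans (↭-sym q) p)

RuleFor : ℕ → ℕ → Set
RuleFor a b = Σ (List ℕ) (Rule (a ∷ b ∷ []))

merges : (a b : ℕ) → List (RuleFor a b)
merges zero    b = []
merges (suc k) b with b ≟ suc (suc k)
... | yes refl = (_ , merge k) ∷ []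
... | no _     = []

splitsOf : (a : ℕ) → List (RuleFor a a)
splitsOf zero                = []
splitsOf (suc zero)          = (_ , split1) ∷ []
splitsOf (suc (suc zero))    = (_ , split2) ∷ []
splitsOf (suc (suc (suc k))) = (_ , splitGe k) ∷ []

splits : (a b : ℕ) → List (RuleFor a b)
splits a b with a ≟ b
... | yes refl = splitsOf a
... | no _     = []

rules : (a b : ℕ) → List (RuleFor a b)
rules a b = merges a b ++ splits a b

rules-complete : ∀ {a b r} (ru : Rule (a ∷ b ∷ []) r) → (r , ru) ∈ rules a b
rules-complete (merge k) with suc (suc k) ≟ suc (suc k)
... | yes refl = here refl
... | no ≢     = ⊥-elim (≢ refl)
rules-complete split1 = here refl
rules-complete split2 = here refl
rules-complete (splitGe k) with 3 + k ≟ 3 + k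
... | yes refl = Any.++⁺ʳ (merges (3 + k) (3 + k)) (here refl)
... | no ≢     = ⊥-elim (≢ refl)

Successor : List ℕ → Set
Successor s = Σ (List ℕ) (Move s)

successorsVia : (s : List ℕ) (ρ : Removal s) → Removal (rest ρ) → List (Successor s)
successorsVia s (removal a _ p) (removal b others p') = map result (rules a b)
  where
  result : RuleFor a b → Successor s
  result (r , ru) = r ++ others , (a ∷ b ∷ [] , r , others , ru , ↭-trans p (prep a p') , ↭-refl)

successors : (s : List ℕ) → List (Successor s)
successors s = concatMap (λ ρ → concatMap (successorsVia s ρ) (removals (rest ρ))) (removals s)

successorsVia-complete : ∀ {s t a b r others} → Rule (a ∷ b ∷ []) r → t ↭ r ++ others →
  (ρ : Removal s) (ρ' : Removal (rest ρ)) → elem ρ ≡ a → elem ρ' ≡ b × rest ρ' ↭ others →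
  Any (λ x → t ↭ proj₁ x) (successorsVia s ρ ρ')
successorsVia-complete {r = r} ru q (removal _ _ _) (removal _ _ _) refl (refl , p) =
  Any.map⁺ (Any.map (λ { refl → ↭-trans q (++⁺ˡ r (↭-sym p)) }) (rules-complete ru))

successors-complete : ∀ {s t} → Move s t → Any (λ x → t ↭ proj₁ x) (successors s)
successors-complete {s} {t} (l , r , others , ru , p , q) with rule-lhs ru
... | a , b , refl = Any.concatMap⁺ _ (Any.map (λ {ρ} → second ρ) (removal-of p))
  where
  second : (ρ : Removal s) → elem ρ ≡ a × rest ρ ↭ b ∷ others →
           Any (λ x → t ↭ proj₁ x) (concatMap (successorsVia s ρ) (removals (rest ρ)))
  second ρ (a≡ , p') =
    Any.concatMap⁺ _ (Any.map (λ {ρ'} → successorsVia-complete ru q ρ ρ' a≡) (removal-of p'))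

weight : (ℕ → ℕ) → List ℕ → ℕ
weight w s = sum (map w s)

weight-split : ∀ w l rest {s} → s ↭ l ++ rest → weight w s ≡ weight w l + weight w rest
weight-split w l rest p =
  ≡-trans (sum-↭ (map⁺ w p)) (≡-trans (cong sum (map-++ w l rest)) (sum-++ (map w l) (map w rest)))

-- The number represented by a state; every rule preserves it (F_{i+1} = F_i + F_{i-1}).
value : List ℕ → ℕ
value = weight fib

rule-value : ∀ {l r} → Rule l r → value l ≡ value r
rule-value (merge k)   = comm (fib (suc k)) (fib (2 + k))
  where
  comm : ∀ a b → a + (b + 0) ≡ b + a + 0
  comm = solve-∀
rule-value split1      = refl
rule-value split2      = refl
rule-value (splitGe k) = redistribute (fib (2 + k)) (fib (1 + k))
  where
  redistribute : ∀ a b → a + b + (a + b + 0) ≡ b + (a + b + a + 0)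
  redistribute = solve-∀

move-value : ∀ {s t} → Move s t → value s ≡ value t
move-value {s} {t} (l , r , others , ru , p , q) = begin
  value s              ≡⟨ weight-split fib l others p ⟩
  value l + value others ≡⟨ cong (_+ value others) (rule-value ru) ⟩
  value r + value others ≡⟨ weight-split fib r others q ⟨
  value t              ∎
  where open ≡-Reasoning

potential : List ℕ → ℕ
potential = weight (3 ^_)

rule-potential : ∀ {l r} → Rule l r → potential l < potential r
rule-potential (merge k)   =
  subst₂ _<_ (sym (lhs (3 ^ k))) (sym (rhs (3 ^ k))) (*-monoˡ-< (3 ^ k) {{m^n≢0 3 k}} (m<m+n 12 {15} z<s))
  where
  lhs : ∀ x → 3 * x + (3 * (3 * x) + 0) ≡ 12 * x
  lhs = solve-∀
  rhs : ∀ x → 3 * (3 * (3 * x)) + 0 ≡ 27 * x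
  rhs = solve-∀
rule-potential split1      = m<m+n 6 z<s
rule-potential split2      = m<m+n 18 z<s
rule-potential (splitGe k) =
  subst₂ _<_ (sym (lhs (3 ^ k))) (sym (rhs (3 ^ k))) (*-monoˡ-< (3 ^ k) {{m^n≢0 3 k}} (m<m+n 54 {30} z<s))
  where
  lhs : ∀ x → 3 * (3 * (3 * x)) + (3 * (3 * (3 * x)) + 0) ≡ 54 * x
  lhs = solve-∀
  rhs : ∀ x → 3 * x + (3 * (3 * (3 * (3 * x))) + 0) ≡ 84 * x
  rhs = solve-∀

move-potential : ∀ {s t} → Move s t → potential s < potential t
move-potential (l , r , others , ru , p , q) =
  subst₂ _<_ (sym (weight-split (3 ^_) l others p)) (sym (weight-split (3 ^_) r others q))
    (+-monoˡ-< (potential others) (rule-potential ru))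

fib-positive : ∀ i → 0 < fib i
fib-positive zero                = z<s
fib-positive (suc zero)          = z<s
fib-positive (suc (suc zero))    = z<s
fib-positive (suc (suc (suc i))) = ≤-trans (fib-positive (suc (suc i))) (m≤m+n _ _)

fib-≥ : ∀ i → i ≤ fib i
fib-≥ zero                = z≤n
fib-≥ (suc zero)          = s≤s z≤n
fib-≥ (suc (suc zero))    = s≤s (s≤s z≤n)
fib-≥ (suc (suc (suc i))) =
  subst₂ _≤_ (cong (λ j → 2 + j) (+-comm i 1)) refl (+-mono-≤ (fib-≥ (suc (suc i))) (fib-positive (suc i)))

-- Every entry i of s has 3^i ≤ 3^N ≤ fib i · 3^N, hence the potential is at most value s · 3^N.
potential-bounded : ∀ N s → value s ≤ N → potential s ≤ value s * 3 ^ N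
potential-bounded N []      _ = z≤n
potential-bounded N (i ∷ s) value≤N = begin
  3 ^ i + potential s            ≤⟨ +-mono-≤ entry (potential-bounded N s (≤-trans (m≤n+m (value s) (fib i)) value≤N)) ⟩
  fib i * 3 ^ N + value s * 3 ^ N ≡⟨ *-distribʳ-+ (3 ^ N) (fib i) (value s) ⟨
  (fib i + value s) * 3 ^ N       ∎
  where
  open ≤-Reasoning
  entry : 3 ^ i ≤ fib i * 3 ^ N
  entry = ≤-trans (^-monoʳ-≤ 3 (≤-trans (fib-≥ i) (≤-trans (m≤m+n (fib i) (value s)) value≤N)))
                  (m≤n*m (3 ^ N) (fib i) {{>-nonZero (fib-positive i)}})

-- The gap below the bound value s · 3^(value s) strictly decreases along moves,
-- because the value is preserved and the potential increases.
gap : List ℕ → ℕ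
gap s = value s * 3 ^ value s ∸ potential s

gap-decreases : ∀ {s t} → Move s t → gap t < gap s
gap-decreases {s} {t} m =
  subst₂ _<_ refl (cong (λ v → v * 3 ^ v ∸ potential s) (sym (move-value m)))
    (∸-monoʳ-< (move-potential m) (potential-bounded (value t) t ≤-refl))

-- By
-- well-founded induction on the gap, each successor is determined; either one of
-- them is lost (move there) or all are won (so every reply loses).
determined-acc : ∀ s → Acc _<_ (gap s) → Win s ⊎ Lose s
determined-acc s (acc smaller) = conclude (any? lost? (successors s))
  where
  next : (x : Successor s) → Win (proj₁ x) ⊎ Lose (proj₁ x)
  next (t , m) = determined-acc t (smaller (gap-decreases m))

  lost? : (x : Successor s) → Dec (Lose (proj₁ x))
  lost? x with next x
  ... | inj₁ w = no (win-lose-exclusive w)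
  ... | inj₂ l = yes l

  won : (x : Successor s) → ¬ Lose (proj₁ x) → Win (proj₁ x)
  won x ¬l with next x
  ... | inj₁ w = w
  ... | inj₂ l = ⊥-elim (¬l l)

  conclude : Dec (Any (λ x → Lose (proj₁ x)) (successors s)) → Win s ⊎ Lose s
  conclude (yes some-lost) with satisfied some-lost
  ... | (t , m) , l = inj₁ (win t m l)
  conclude (no none-lost) = inj₂ (lose λ t m →
    lookupWith (λ {x} ¬l t↭x → win-↭ (↭-sym t↭x) (won x ¬l))
               (¬Any⇒All¬ (successors s) none-lost) (successors-complete m))

determined : ∀ s → Win s ⊎ Lose s
determined s = determined-acc s (<-wellFounded (gap s))

lost-if-not-won : ∀ s → ¬ Win s → Lose s
lost-if-not-won s ¬won with determined s
... | inj₁ w = ⊥-elim (¬won w)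
... | inj₂ l = l

Terminal : List ℕ → Set
Terminal s = ∀ {t} → ¬ Move s t

terminal-lost : ∀ {s} → Terminal s → Lose s
terminal-lost terminal = lose λ _ m → ⊥-elim (terminal m)

-- Every rule consumes two entries.
short-terminal : ∀ {s} → length s < 2 → Terminal s
short-terminal {s} short (l , r , others , ru , p , _) with rule-lhs ru
... | a , b , refl = <-irrefl refl (≤-<-trans (subst (2 ≤_) (sym (↭-length p)) (m≤m+n 2 (length others))) short)

pair-move : ∀ {x y t} → Move (x ∷ y ∷ []) t →
  ∃[ r ] (Rule (x ∷ y ∷ []) r ⊎ Rule (y ∷ x ∷ []) r) × t ↭ r
pair-move (_ , _ , _ ∷ _ , ru , p , _) with rule-lhs ru
... | _ , _ , refl with ↭-length p
...   | ()
pair-move {x} {y} (_ , r , [] , ru , p , q) with rule-lhs ru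
... | a , b , refl with ∈-resp-↭ (↭-sym p) (here refl)
...   | here refl with refl ← ↭-singleton-inv (drop-∷ p) =
        r , inj₁ ru , ↭-trans q (↭-reflexive (++-identityʳ r))
...   | there (here refl) with refl ← ↭-singleton-inv (drop-∷ (↭-trans (swap y x ↭-refl) p)) =
        r , inj₂ ru , ↭-trans q (↭-reflexive (++-identityʳ r))

-- (3,3) can only be split into (1,4), and (2,4) is the Zeckendorf decomposition of 7.
moves-33 : ∀ {t} → Move (3 ∷ 3 ∷ []) t → t ↭ 1 ∷ 4 ∷ []
moves-33 m with pair-move m
... | _ , inj₁ (splitGe 0) , q = q
... | _ , inj₂ (splitGe 0) , q = q

terminal-24 : Terminal (2 ∷ 4 ∷ [])
terminal-24 m with pair-move m
... | _ , inj₁ () , _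
... | _ , inj₂ () , _

ones : ℕ → List ℕ
ones m = replicate m 1

3≤3 : 3 ≤ 3
3≤3 = s≤s (s≤s (s≤s z≤n))

3≤4 : 3 ≤ 4
3≤4 = s≤s (s≤s (s≤s z≤n))

∈-ones : ∀ {a m} → a ∈ ones m → ∃[ m' ] m ≡ suc m' × a ≡ 1
∈-ones {m = suc m'} (here refl) = m' , refl , refl
∈-ones {m = suc m'} (there a∈) with ∈-ones a∈
... | _ , refl , refl = m' , refl , refl

remove-from-ones : ∀ m T {a u} → ones m ++ T ↭ a ∷ u →
    (a ≡ 1 × ∃[ m' ] m ≡ suc m' × ones m' ++ T ↭ u)
  ⊎ (∃[ T' ] T ↭ a ∷ T' × ones m ++ T' ↭ u)
remove-from-ones m T {a} p with ∈-++⁻ (ones m) (∈-resp-↭ (↭-sym p) (here refl))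
... | inj₁ a∈ones with ∈-ones a∈ones
...   | m' , refl , refl = inj₁ (refl , m' , refl , drop-∷ p)
remove-from-ones m T {a} p | inj₂ a∈T with satisfied (removals-complete a∈T)
... | removal _ T' q , refl =
  inj₂ (T' , q , drop-∷ (↭-trans (↭-sym (shift a (ones m) T')) (↭-trans (++⁺ˡ (ones m) (↭-sym q)) p)))

rule-11 : ∀ {r} → Rule (1 ∷ 1 ∷ []) r → r ≡ 2 ∷ []
rule-11 split1 = refl

no-rule-1-large : ∀ {b r} → 3 ≤ b → ¬ Rule (1 ∷ b ∷ []) r
no-rule-1-large (s≤s (s≤s ())) (merge 0)

no-rule-large-1 : ∀ {a r} → 3 ≤ a → ¬ Rule (a ∷ 1 ∷ []) r
no-rule-large-1 (s≤s ()) split1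

moves-from-ones : ∀ m T {t} → All (3 ≤_) T → Move (ones m ++ T) t →
    (∃[ m' ] m ≡ 2 + m' × t ↭ ones m' ++ 2 ∷ T)
  ⊎ (∃[ t' ] Move T t' × t ↭ ones m ++ t')
moves-from-ones m T large (_ , r , others , ru , p , q) with rule-lhs ru
... | a , b , refl with remove-from-ones m T p
...   | inj₁ (refl , m' , refl , p') with remove-from-ones m' T p'
...     | inj₂ (_ , pT , _) = ⊥-elim (no-rule-1-large (All-head (All-resp-↭ pT large)) ru)
...     | inj₁ (refl , m'' , refl , p'') with refl ← rule-11 ru =
          inj₁ (m'' , refl , ↭-trans q (↭-trans (prep 2 (↭-sym p'')) (↭-sym (shift 2 (ones m'') T))))
moves-from-ones m T large (_ , r , others , ru , p , q) | a , b , refl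
      | inj₂ (T' , pT , p') with remove-from-ones m T' p'
...     | inj₁ (refl , _) = ⊥-elim (no-rule-large-1 (All-head (All-resp-↭ pT large)) ru)
...     | inj₂ (T'' , pT' , p'') =
          inj₂ (r ++ T'' , (a ∷ b ∷ [] , r , T'' , ru , ↭-trans pT (prep a pT') , ↭-refl) ,
                ↭-trans q (↭-trans (++⁺ˡ r (↭-sym p'')) (shifts r (ones m))))

only-merge : ∀ m T {t} → All (3 ≤_) T → Terminal T → Move (ones m ++ T) t →
  ∃[ m' ] m ≡ 2 + m' × t ↭ ones m' ++ 2 ∷ T
only-merge m T large terminal mv with moves-from-ones m T large mv
... | inj₁ merged          = merged
... | inj₂ (_ , mv' , _) = ⊥-elim (terminal mv')

moves-ones : ∀ m {t} → Move (ones (2 + m)) t → t ↭ ones m ++ 2 ∷ []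
moves-ones m mv with only-merge (2 + m) [] [] (short-terminal (s≤s z≤n))
                       (move-↭ (↭-reflexive (sym (++-identityʳ (ones (2 + m))))) ↭-refl mv)
... | _ , refl , q = q

moves-33-with-ones : ∀ m {t} → Move (ones m ++ 3 ∷ 3 ∷ []) t →
  (∃[ m' ] m ≡ 2 + m' × t ↭ ones m' ++ 2 ∷ 3 ∷ 3 ∷ []) ⊎ t ↭ ones (1 + m) ++ 4 ∷ []
moves-33-with-ones m mv with moves-from-ones m (3 ∷ 3 ∷ []) (3≤3 ∷ 3≤3 ∷ []) mv
... | inj₁ merged = inj₁ merged
... | inj₂ (t' , mv' , q) =
  inj₂ (↭-trans q (↭-trans (++⁺ˡ (ones m) (moves-33 mv')) (shift 1 (ones m) (4 ∷ []))))

moves-ones-single : ∀ m x {t} → 3 ≤ x → Move (ones (2 + m) ++ x ∷ []) t → t ↭ ones m ++ 2 ∷ x ∷ []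
moves-ones-single m x 3≤x mv with only-merge (2 + m) (x ∷ []) (3≤x ∷ []) (short-terminal (s≤s (s≤s z≤n))) mv
... | _ , refl , q = q

terminal-ones-single : ∀ m x → 3 ≤ x → m < 2 → Terminal (ones m ++ x ∷ [])
terminal-ones-single m x 3≤x m<2 mv with only-merge m (x ∷ []) (3≤x ∷ []) (short-terminal (s≤s (s≤s z≤n))) mv
... | _ , refl , _ = <-irrefl refl (≤-<-trans (m≤m+n 2 _) m<2)

rule-move : ∀ m T {a b r} → Rule (a ∷ b ∷ []) r → Move (ones m ++ a ∷ b ∷ T) (ones m ++ r ++ T)
rule-move m T {a} {b} {r} ru = a ∷ b ∷ [] , r , ones m ++ T , ru , shifts (ones m) (a ∷ b ∷ []) , shifts (ones m) r

merge-11 : ∀ m T → Move (ones (2 + m) ++ T) (ones m ++ 2 ∷ T)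
merge-11 m T = move-↭ ↭-refl (↭-sym (shift 2 (ones m) T)) (rule-move 0 (ones m ++ T) split1)

merge-12 : ∀ m T → Move (ones (1 + m) ++ 2 ∷ T) (ones m ++ 3 ∷ T)
merge-12 m T = move-↭ (shift 1 (ones m) (2 ∷ T)) ↭-refl (rule-move m T (merge 0))

merge-23 : ∀ m T → Move (ones m ++ 2 ∷ 3 ∷ T) (ones m ++ 4 ∷ T)
merge-23 m T = rule-move m T (merge 1)

split-33 : ∀ m → Move (ones m ++ 2 ∷ 3 ∷ 3 ∷ []) (ones (1 + m) ++ 2 ∷ 4 ∷ [])
split-33 m = move-↭ (++⁺ˡ (ones m) (shift 2 (3 ∷ 3 ∷ []) []))
                    (↭-trans (shift 1 (ones m) (4 ∷ 2 ∷ [])) (prep 1 (++⁺ˡ (ones m) (swap 4 2 ↭-refl))))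
                    (rule-move m (2 ∷ []) (splitGe 0))

-- On 1^(3+m) the first move is forced to 1^(1+m) ++ [2]; answering with 1+2 → 3
-- wins for the second player whenever 1^m ++ [3] is lost.
lost-if-tail-3-lost : ∀ m → Lose (ones m ++ 3 ∷ []) → Lose (ones (3 + m))
lost-if-tail-3-lost m l = only-move-lost (moves-ones (1 + m)) (win _ (merge-12 m []) l)

tail-3-lost : ∀ m → m ≤ 4 → Lose (ones m ++ 3 ∷ [])
tail-3-lost 0 _ = terminal-lost (terminal-ones-single 0 3 3≤3 (s≤s z≤n))
tail-3-lost 1 _ = terminal-lost (terminal-ones-single 1 3 3≤3 (s≤s (s≤s z≤n)))
tail-3-lost 2 _ = only-move-lost (moves-ones-single 0 3 3≤3)
  (win _ (merge-23 0 []) (terminal-lost (terminal-ones-single 0 4 3≤4 (s≤s z≤n))))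
tail-3-lost 3 _ = only-move-lost (moves-ones-single 1 3 3≤3)
  (win _ (merge-23 1 []) (terminal-lost (terminal-ones-single 1 4 3≤4 (s≤s (s≤s z≤n)))))
tail-3-lost 4 _ = only-move-lost (moves-ones-single 2 3 3≤3) (win _ (merge-12 1 (3 ∷ [])) lose-133)
  where
  lose-133 : Lose (ones 1 ++ 3 ∷ 3 ∷ [])
  lose-133 = only-move-lost only-split (win _ (merge-11 0 (4 ∷ [])) (terminal-lost terminal-24))
    where
    only-split : ∀ {t} → Move (ones 1 ++ 3 ∷ 3 ∷ []) t → t ↭ ones 2 ++ 4 ∷ []
    only-split mv with moves-33-with-ones 1 mv
    ... | inj₁ (_ , () , _)
    ... | inj₂ q = q
tail-3-lost (suc (suc (suc (suc (suc _))))) (s≤s (s≤s (s≤s (s≤s ()))))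

-- Strategy stealing for n = 8 + k: if the first player could win, following the
-- forced and winning replies makes 1^(1+k) ++ [2,4] both lost and won.  The
-- local states are named after their entries other than 1.
first-player-cannot-win : ∀ k → ¬ Win (ones (8 + k))
first-player-cannot-win k w = win-lose-exclusive win-24 lose-24
  where
  lose-2 : Lose (ones (6 + k) ++ 2 ∷ [])
  lose-2 = reply-lost (λ mv → inj₁ (moves-ones (6 + k) mv)) w
  win-3 : Win (ones (5 + k) ++ 3 ∷ [])
  win-3 = won-after lose-2 (merge-12 (5 + k) [])
  lose-23 : Lose (ones (3 + k) ++ 2 ∷ 3 ∷ [])
  lose-23 = reply-lost (λ mv → inj₁ (moves-ones-single (3 + k) 3 3≤3 mv)) win-3
  win-4 : Win (ones (3 + k) ++ 4 ∷ [])
  win-4 = won-after lose-23 (merge-23 (3 + k) [])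
  win-33 : Win (ones (2 + k) ++ 3 ∷ 3 ∷ [])
  win-33 = won-after lose-23 (merge-12 (2 + k) (3 ∷ []))
  lose-24 : Lose (ones (1 + k) ++ 2 ∷ 4 ∷ [])
  lose-24 = reply-lost (λ mv → inj₁ (moves-ones-single (1 + k) 4 3≤4 mv)) win-4
  -- splitting (3,3) would hand the opponent the won state 1^(3+k) ++ [4]
  replies-33 : ∀ {t} → Move (ones (2 + k) ++ 3 ∷ 3 ∷ []) t → t ↭ ones k ++ 2 ∷ 3 ∷ 3 ∷ [] ⊎ Win t
  replies-33 mv with moves-33-with-ones (2 + k) mv
  ... | inj₁ (_ , refl , q) = inj₁ q
  ... | inj₂ q = inj₂ (win-↭ (↭-sym q) win-4)
  lose-233 : Lose (ones k ++ 2 ∷ 3 ∷ 3 ∷ [])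
  lose-233 = reply-lost replies-33 win-33
  win-24 : Win (ones (1 + k) ++ 2 ∷ 4 ∷ [])
  win-24 = won-after lose-233 (split-33 k)

second-player-wins-large : ∀ k → Lose (ones (8 + k))
second-player-wins-large k = lost-if-not-won (ones (8 + k)) (first-player-cannot-win k)

theorem1p7 : (n : ℕ) → 2 < n → Lose (initial n)
theorem1p7 0 ()
theorem1p7 1 (s≤s ())
theorem1p7 2 (s≤s (s≤s ()))
theorem1p7 (suc (suc (suc m))) _ with m ≤? 4
... | yes m≤4 = lost-if-tail-3-lost m (tail-3-lost m m≤4)
... | no m≰4 with k , refl ← m≤n⇒∃[o]m+o≡n (≰⇒> m≰4) = second-player-wins-large k
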